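{- For all integers $n_1\ge n_2\ge n_3\ge 2$, $$m_0(1,n_1,n_2,n_3) = n_1+n_2+n_3-2.$$
   Context: For $1\le \ell\le r$ let $X_\ell=\{1,\dots,n_\ell\}$. An $r$-partite $r$-graph is a family $\mathcal{F}\subseteq X_1\times\dots\times X_r$; for $A$ in this product, $A[\ell]$ denotes its $\ell$-th coordinate. Viewing $X_1,\dots,X_r$ as pairwise disjoint sets, each sequence $A$ is identified with the $r$-element set $\{A[1],\dots,A[r]\}\subseteq X_1\sqcup\dots\sqcup X_r$. Two sequences $A,B$ are disjoint if $A[\ell]\ne B[\ell]$ for all $\ell$; a matching is a collection of pairwise disjoint members; $\nu(\mathcal{F})$ is the maximum size of a matching in $\mathcal{F}$. A transversal of $\mathcal{F}$ is a set $T\subseteq X_1\sqcup\dots\sqcup X_r$ meeting every member of $\mathcal{F}$, and $\tau(\mathcal{F})$ is the minimum size of a transversal. For $r\ge 3$ and $n_1\ge\dots\ge n_r>s\ge1$, $m_0(s,n_1,\dots,n_r)$ is the maximum of $|\mathcal{F}|$ over $\mathcal{F}\subseteq X_1\times\dots\times X_r$ with $\nu(\mathcal{F})\le s<\tau(\mathcal{F})$. -}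

module Defs where

open import Data.Nat using (ℕ; _+_; _≤_; _<_)
open import Data.Bool using (Bool; true; false; if_then_else_)
open import Data.Fin using (Fin)
open import Data.Fin.Subset using (Subset; _∈_; ∣_∣)
open import Data.Product using (_×_; _,_; Σ)
open import Data.Sum using (_⊎_)
open import Data.List using (List; length; map; allFin)
open import Data.Nat.ListAction using (sum)
open import Data.List.Relation.Unary.All using (All)
open import Data.List.Relation.Unary.AllPairs using (AllPairs)
open import Relation.Binary.PropositionalEquality using (_≡_; _≢_)

-- Vertex classes X_1, X_2, X_3 are Fin a, Fin b, Fin c (elements 0..n-1
-- instead of 1..n).  A member of X_1 × X_2 × X_3:
Triple : ℕ → ℕ → ℕ → Set
Triple a b c = Fin a × Fin b × Fin c

-- A 3-partite 3-graph F ⊆ X_1 × X_2 × X_3, given by its (decidable)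
-- characteristic function.
Family : ℕ → ℕ → ℕ → Set
Family a b c = Triple a b c → Bool

_∈F_ : ∀ {a b c} → Triple a b c → Family a b c → Set
A ∈F F = F A ≡ true

size : ∀ {a b c} → Family a b c → ℕ
size {a} {b} {c} F =
  sum (map (λ i → sum (map (λ j → sum (map (λ k → if F (i , j , k) then 1 else 0)
    (allFin c))) (allFin b))) (allFin a))

Disjoint : ∀ {a b c} → Triple a b c → Triple a b c → Set
Disjoint (x₁ , x₂ , x₃) (y₁ , y₂ , y₃) = (x₁ ≢ y₁) × (x₂ ≢ y₂) × (x₃ ≢ y₃)

IsMatching : ∀ {a b c} → Family a b c → List (Triple a b c) → Set
IsMatching F M = All (λ A → A ∈F F) M × AllPairs Disjoint M

νAtMost : ∀ {a b c} → Family a b c → ℕ → Set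
νAtMost F s = ∀ M → IsMatching F M → length M ≤ s

-- A transversal: a subset T = T₁ ⊔ T₂ ⊔ T₃ of X_1 ⊔ X_2 ⊔ X_3
-- meeting every member of F
Vertices : ℕ → ℕ → ℕ → Set
Vertices a b c = Subset a × Subset b × Subset c

vsize : ∀ {a b c} → Vertices a b c → ℕ
vsize (T₁ , T₂ , T₃) = ∣ T₁ ∣ + ∣ T₂ ∣ + ∣ T₃ ∣

IsTransversal : ∀ {a b c} → Family a b c → Vertices a b c → Set
IsTransversal F (T₁ , T₂ , T₃) =
  ∀ x₁ x₂ x₃ → (x₁ , x₂ , x₃) ∈F F → (x₁ ∈ T₁) ⊎ (x₂ ∈ T₂) ⊎ (x₃ ∈ T₃)

τExceeds : ∀ {a b c} → Family a b c → ℕ → Set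
τExceeds F s = ∀ T → IsTransversal F T → s < vsize T

Admissible : ∀ {a b c} → ℕ → Family a b c → Set
Admissible s F = νAtMost F s × τExceeds F s

-- m₀(s, a, b, c) = m : m is the maximum of |F| over admissible F
-- (attained, and an upper bound)
M0Is : ℕ → ℕ → ℕ → ℕ → ℕ → Set
M0Is s a b c m =
  Σ (Family a b c) (λ F → Admissible s F × size F ≡ m)
  × (∀ (F : Family a b c) → Admissible s F → size F ≤ m)

{-# OPTIONS --safe #-}
-- ν(F) ≤ 1 < τ(F) says that F is intersecting, non-empty, and no vertex lies in all members.
-- Such an F has two members sharing exactly one coordinate, say (a,b,c) and (a,b′,c′).  A
-- member avoiding a meets both, so it is (x,b,c′) or (x,b′,c); in the first case either
-- (x,b′,c) ∈ F, and then F has no members besides these four, or every member shares two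
-- coordinates with (a,b,c′).  The triples sharing two coordinates with a fixed s form the
-- union of the three lines through s, of size n₁ + n₂ + n₃ − 2, and this family is itself
-- admissible.
module Submission where

open import Defs
open import Data.Bool using (Bool; true; false; if_then_else_; _∧_; _∨_) renaming (_≟_ to _≟ᵇ_)
open import Data.Empty using (⊥-elim)
open import Data.Fin using (Fin; zero; suc; _≟_; punchIn)
open import Data.Fin.Properties using (any?; punchInᵢ≢i)
open import Data.Fin.Subset using (Subset; _∈_; _∉_; _⊆_; ∣_∣; ⁅_⁆; ⊥)
open import Data.Fin.Subset.Properties
  using (_∈?_; x∈⁅x⁆; x∈⁅y⁆⇒x≡y; ∣⁅x⁆∣≡1; ∣⊥∣≡0; p⊆q⇒∣p∣≤∣q∣; p⊂q⇒∣p∣<∣q∣)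
open import Data.List using (List; []; _∷_; map; allFin; tabulate; length)
import Data.List.Membership.Propositional as List
open import Data.List.Membership.Propositional.Properties using (∈-map⁺)
open import Data.List.Relation.Unary.All using ([]; _∷_)
open import Data.List.Relation.Unary.AllPairs using ([]; _∷_)
open import Data.List.Relation.Unary.Any using (here; there)
open import Data.Nat using (ℕ; zero; suc; _+_; _*_; _∸_; _≤_; _<_; _≥_; z≤n; s≤s)
import Data.Nat.ListAction as List
open import Data.Nat.Properties
  using (+-*-semiring; +-assoc; +-mono-≤; ≤-trans; ≤-reflexive; m≤m+n; m≤n+m; m+n∸n≡m; ∸-monoˡ-≤;
         <⇒≱; 1+n≰n)
open import Algebra.Properties.Semiring.Sum +-*-semiring
  using (sum; sum-syntax; sum-cong-≗; sum-replicate-zero; ∑-distrib-+; *-distribˡ-sum; *-distribʳ-sum)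
open import Data.Nat.Tactic.RingSolver using (solve-∀)
open import Data.Product using (_×_; _,_; ∃-syntax)
open import Data.Sum using (_⊎_; inj₁; inj₂)
open import Function using (_∘_; id)
open import Relation.Nullary using (¬_; Dec; does; proof; yes; no; ¬?; _×-dec_; _⊎-dec_)
open import Relation.Nullary.Decidable using (dec-true; decidable-stable)
open import Relation.Nullary.Reflects using (Reflects; invert)
open import Relation.Unary using (Decidable)
open import Relation.Binary.Definitions using (DecidableEquality)
open import Relation.Binary.PropositionalEquality
  using (_≡_; _≢_; refl; sym; trans; subst; cong; cong₂; ≢-sym; module ≡-Reasoning)

-- Non-trivial intersecting families of triples

variable
  X Y Z : Set

Meets : X × Y × Z → X × Y × Z → Set
Meets (x , y , z) (x′ , y′ , z′) = x ≡ x′ ⊎ y ≡ y′ ⊎ z ≡ z′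

MeetsTwice : X × Y × Z → X × Y × Z → Set
MeetsTwice (x , y , z) (x′ , y′ , z′) = x ≡ x′ × y ≡ y′ ⊎ x ≡ x′ × z ≡ z′ ⊎ y ≡ y′ × z ≡ z′

meetsTwice-meets : {s t u : X × Y × Z} → MeetsTwice s t → MeetsTwice s u → Meets t u
meetsTwice-meets (inj₁ (refl , _))        (inj₁ (refl , _))        = inj₁ refl
meetsTwice-meets (inj₁ (refl , _))        (inj₂ (inj₁ (refl , _))) = inj₁ refl
meetsTwice-meets (inj₁ (_ , refl))        (inj₂ (inj₂ (refl , _))) = inj₂ (inj₁ refl)
meetsTwice-meets (inj₂ (inj₁ (refl , _))) (inj₁ (refl , _))        = inj₁ refl
meetsTwice-meets (inj₂ (inj₁ (refl , _))) (inj₂ (inj₁ (refl , _))) = inj₁ refl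
meetsTwice-meets (inj₂ (inj₁ (_ , refl))) (inj₂ (inj₂ (_ , refl))) = inj₂ (inj₂ refl)
meetsTwice-meets (inj₂ (inj₂ (refl , _))) (inj₁ (_ , refl))        = inj₂ (inj₁ refl)
meetsTwice-meets (inj₂ (inj₂ (_ , refl))) (inj₂ (inj₁ (_ , refl))) = inj₂ (inj₂ refl)
meetsTwice-meets (inj₂ (inj₂ (refl , _))) (inj₂ (inj₂ (refl , _))) = inj₂ (inj₁ refl)

Intersecting : (X × Y × Z → Set) → Set
Intersecting P = ∀ {t u} → P t → P u → Meets t u

record NonTrivialIntersecting (P : X × Y × Z → Set) : Set where
  field
    intersecting : Intersecting P
    member       : ∃[ t ] P t
    avoid₁       : ∀ x → ∃[ x′ ] ∃[ y ] ∃[ z ] P (x′ , y , z) × x′ ≢ x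
    avoid₂       : ∀ y → ∃[ x ] ∃[ y′ ] ∃[ z ] P (x , y′ , z) × y′ ≢ y
    avoid₃       : ∀ z → ∃[ x ] ∃[ y ] ∃[ z′ ] P (x , y , z′) × z′ ≢ z

data Shape (P : X × Y × Z → Set) : Set where
  centred    : ∀ s → (∀ {t} → P t → MeetsTwice s t) → Shape P
  fourPoints : ∀ p₁ p₂ p₃ p₄ → (∀ {t} → P t → t List.∈ p₁ ∷ p₂ ∷ p₃ ∷ p₄ ∷ []) → Shape P

-- The argument is carried out for a pair sharing the first coordinate; the other two
-- coordinates are reduced to it by rotating the family.
rotate : Y × Z × X → X × Y × Z
rotate (y , z , x) = (x , y , z)

module _ {P : X × Y × Z → Set} where

  nonTrivialIntersecting-rotate : NonTrivialIntersecting P → NonTrivialIntersecting (P ∘ rotate)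
  nonTrivialIntersecting-rotate N = record
    { intersecting = intersecting-rotate
    ; member       = let (x , y , z) , p = member in (y , z , x) , p
    ; avoid₁       = λ y → let x , y′ , z , p , y′≢y = avoid₂ y in y′ , z , x , p , y′≢y
    ; avoid₂       = λ z → let x , y , z′ , p , z′≢z = avoid₃ z in y , z′ , x , p , z′≢z
    ; avoid₃       = λ x → let x′ , y , z , p , x′≢x = avoid₁ x in y , z , x′ , p , x′≢x
    }
    where
    open NonTrivialIntersecting N
    intersecting-rotate : Intersecting (P ∘ rotate)
    intersecting-rotate p q with intersecting p q
    ... | inj₁ e        = inj₂ (inj₂ e)
    ... | inj₂ (inj₁ e) = inj₁ e
    ... | inj₂ (inj₂ e) = inj₂ (inj₁ e)

  shape-unrotate : Shape (P ∘ rotate) → Shape P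
  shape-unrotate (centred s P⊆) =
    centred (rotate s) λ {(x , y , z)} p → meetsTwice-rotate (P⊆ {y , z , x} p)
    where
    meetsTwice-rotate : {s t : Y × Z × X} → MeetsTwice s t → MeetsTwice (rotate s) (rotate t)
    meetsTwice-rotate (inj₁ e)               = inj₂ (inj₂ e)
    meetsTwice-rotate (inj₂ (inj₁ (e , e′))) = inj₁ (e′ , e)
    meetsTwice-rotate (inj₂ (inj₂ (e , e′))) = inj₂ (inj₁ (e′ , e))
  shape-unrotate (fourPoints p₁ p₂ p₃ p₄ P⊆) =
    fourPoints (rotate p₁) (rotate p₂) (rotate p₃) (rotate p₄)
      λ {(x , y , z)} p → ∈-map⁺ rotate (P⊆ {y , z , x} p)

module _ {P : X × Y × Z → Set} (P? : Decidable P) (N : NonTrivialIntersecting P) where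
  open NonTrivialIntersecting N

  crossing : ∀ {a b b′ c c′ i j k} → P (a , b , c) → P (a , b′ , c′) → b ≢ b′ → c ≢ c′ →
             P (i , j , k) → i ≢ a → j ≡ b × k ≡ c′ ⊎ j ≡ b′ × k ≡ c
  crossing A B b≢b′ c≢c′ T i≢a with intersecting T A | intersecting T B
  ... | inj₁ i≡a         | _                = ⊥-elim (i≢a i≡a)
  ... | _                | inj₁ i≡a         = ⊥-elim (i≢a i≡a)
  ... | inj₂ (inj₁ refl) | inj₂ (inj₁ b≡b′) = ⊥-elim (b≢b′ b≡b′)
  ... | inj₂ (inj₁ j≡b)  | inj₂ (inj₂ k≡c′) = inj₁ (j≡b , k≡c′)
  ... | inj₂ (inj₂ k≡c)  | inj₂ (inj₁ j≡b′) = inj₂ (j≡b′ , k≡c)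
  ... | inj₂ (inj₂ refl) | inj₂ (inj₂ c≡c′) = ⊥-elim (c≢c′ c≡c′)

  shape-triangle : DecidableEquality X → ∀ {a b b′ c c′ x} →
                   P (a , b , c) → P (a , b′ , c′) → P (x , b , c′) → b ≢ b′ → c ≢ c′ → x ≢ a → Shape P
  shape-triangle _≟₁_ {a} {b} {b′} {c} {c′} {x} A B D b≢b′ c≢c′ x≢a with P? (x , b′ , c)
  ... | yes E = fourPoints _ _ _ _ among-four
    where
    among-four : ∀ {t} → P t → t List.∈ (a , b , c) ∷ (a , b′ , c′) ∷ (x , b , c′) ∷ (x , b′ , c) ∷ []
    among-four {i , j , k} T with i ≟₁ a
    among-four {i , j , k} T | yes refl with intersecting T D | intersecting T E
    ... | inj₁ refl        | _                = ⊥-elim (x≢a refl)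
    ... | _                | inj₁ refl        = ⊥-elim (x≢a refl)
    ... | inj₂ (inj₁ refl) | inj₂ (inj₂ refl) = here refl
    ... | inj₂ (inj₂ refl) | inj₂ (inj₁ refl) = there (here refl)
    ... | inj₂ (inj₁ refl) | inj₂ (inj₁ b≡b′) = ⊥-elim (b≢b′ b≡b′)
    ... | inj₂ (inj₂ refl) | inj₂ (inj₂ c′≡c) = ⊥-elim (c≢c′ (sym c′≡c))
    among-four {i , j , k} T | no i≢a with crossing A B b≢b′ c≢c′ T i≢a
    among-four {i , j , k} T | no i≢a | inj₁ (refl , refl) with intersecting T E
    ... | inj₁ refl        = there (there (here refl))
    ... | inj₂ (inj₁ b≡b′) = ⊥-elim (b≢b′ b≡b′)
    ... | inj₂ (inj₂ c′≡c) = ⊥-elim (c≢c′ (sym c′≡c))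
    among-four {i , j , k} T | no i≢a | inj₂ (refl , refl) with intersecting T D
    ... | inj₁ refl        = there (there (there (here refl)))
    ... | inj₂ (inj₁ b′≡b) = ⊥-elim (b≢b′ (sym b′≡b))
    ... | inj₂ (inj₂ c≡c′) = ⊥-elim (c≢c′ c≡c′)
  ... | no ¬E = centred (a , b , c′) meetsTwice-centre
    where
    meetsTwice-centre : ∀ {t} → P t → MeetsTwice (a , b , c′) t
    meetsTwice-centre {i , j , k} T with i ≟₁ a
    meetsTwice-centre {i , j , k} T | yes refl with intersecting T D
    ... | inj₁ refl        = ⊥-elim (x≢a refl)
    ... | inj₂ (inj₁ refl) = inj₁ (refl , refl)
    ... | inj₂ (inj₂ refl) = inj₂ (inj₁ (refl , refl))
    meetsTwice-centre {i , j , k} T | no i≢a with crossing A B b≢b′ c≢c′ T i≢a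
    ... | inj₁ (refl , refl) = inj₂ (inj₂ (refl , refl))
    ... | inj₂ (refl , refl) with intersecting T D
    ...   | inj₁ refl        = ⊥-elim (¬E T)
    ...   | inj₂ (inj₁ b′≡b) = ⊥-elim (b≢b′ (sym b′≡b))
    ...   | inj₂ (inj₂ c≡c′) = ⊥-elim (c≢c′ c≡c′)

  shape-sharingFirst : DecidableEquality X → ∀ {a b b′ c c′} →
                       P (a , b , c) → P (a , b′ , c′) → b ≢ b′ → c ≢ c′ → Shape P
  shape-sharingFirst _≟₁_ {a} A B b≢b′ c≢c′ with avoid₁ a
  ... | x , _ , _ , D , x≢a with crossing A B b≢b′ c≢c′ D x≢a
  ...   | inj₁ (refl , refl) = shape-triangle _≟₁_ A B D b≢b′ c≢c′ x≢a
  ...   | inj₂ (refl , refl) = shape-triangle _≟₁_ B A D (≢-sym b≢b′) (≢-sym c≢c′) x≢a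

module _ {P : X × Y × Z → Set} (P? : Decidable P) (N : NonTrivialIntersecting P) where
  open NonTrivialIntersecting N

  shape-sharingSecond : DecidableEquality Y → ∀ {a a′ b c c′} →
                        P (a , b , c) → P (a′ , b , c′) → a ≢ a′ → c ≢ c′ → Shape P
  shape-sharingSecond _≟₂_ A B a≢a′ c≢c′ = shape-unrotate
    (shape-sharingFirst (P? ∘ rotate) (nonTrivialIntersecting-rotate N) _≟₂_ A B c≢c′ a≢a′)

  shape-sharingThird : DecidableEquality Z → ∀ {a a′ b b′ c} →
                       P (a , b , c) → P (a′ , b′ , c) → a ≢ a′ → b ≢ b′ → Shape P
  shape-sharingThird _≟₃_ A B a≢a′ b≢b′ = shape-unrotate (shape-unrotate
    (shape-sharingFirst (P? ∘ rotate ∘ rotate)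
      (nonTrivialIntersecting-rotate (nonTrivialIntersecting-rotate N)) _≟₃_ A B a≢a′ b≢b′))

  twins-force-third : ∀ {a b c x i j k} → P (a , b , c) → P (x , b , c) → x ≢ a →
                      P (i , j , k) → j ≢ b → k ≡ c
  twins-force-third A D x≢a E j≢b with intersecting E A | intersecting E D
  ... | inj₂ (inj₂ k≡c) | _               = k≡c
  ... | _               | inj₂ (inj₂ k≡c) = k≡c
  ... | inj₂ (inj₁ j≡b) | _               = ⊥-elim (j≢b j≡b)
  ... | _               | inj₂ (inj₁ j≡b) = ⊥-elim (j≢b j≡b)
  ... | inj₁ refl       | inj₁ refl       = ⊥-elim (x≢a refl)

  shape-twins : DecidableEquality X → DecidableEquality Z → ∀ {a b c x} →
                P (a , b , c) → P (x , b , c) → x ≢ a → Shape P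
  shape-twins _≟₁_ _≟₃_ {a} {b} A D x≢a with avoid₂ b
  ... | i , j , k , E , j≢b with twins-force-third A D x≢a E j≢b | i ≟₁ a
  ...   | refl | yes refl = shape-sharingThird _≟₃_ D E x≢a (≢-sym j≢b)
  ...   | refl | no i≢a   = shape-sharingThird _≟₃_ A E (≢-sym i≢a) (≢-sym j≢b)

  shape : DecidableEquality X → DecidableEquality Y → DecidableEquality Z → Shape P
  shape _≟₁_ _≟₂_ _≟₃_ with member
  ... | (a , b , c) , A with avoid₁ a
  ...   | x , y , z , D , x≢a with intersecting D A | y ≟₂ b | z ≟₃ c
  ...     | inj₁ x≡a        | _        | _        = ⊥-elim (x≢a x≡a)
  ...     | _               | yes refl | yes refl = shape-twins _≟₁_ _≟₃_ A D x≢a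
  ...     | _               | yes refl | no z≢c   = shape-sharingSecond _≟₂_ A D (≢-sym x≢a) (≢-sym z≢c)
  ...     | _               | no y≢b   | yes refl = shape-sharingThird _≟₃_ A D (≢-sym x≢a) (≢-sym y≢b)
  ...     | inj₂ (inj₁ y≡b) | no y≢b   | no _     = ⊥-elim (y≢b y≡b)
  ...     | inj₂ (inj₂ z≡c) | no _     | no z≢c   = ⊥-elim (z≢c z≡c)

-- Counting triples

⟦_⟧ : Bool → ℕ
⟦ b ⟧ = if b then 1 else 0

δ : ∀ {n} → Fin n → Fin n → ℕ
δ p i = ⟦ does (p ≟ i) ⟧

δ-refl : ∀ {n} (p : Fin n) → δ p p ≡ 1
δ-refl p = cong ⟦_⟧ (dec-true (p ≟ p) refl)

sum-map-tabulate : ∀ {A : Set} {n} (g : Fin n → A) (f : A → ℕ) →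
                   List.sum (map f (tabulate g)) ≡ sum (f ∘ g)
sum-map-tabulate {n = zero}  g f = refl
sum-map-tabulate {n = suc n} g f = cong (f (g zero) +_) (sum-map-tabulate (g ∘ suc) f)

sum-mono-≤ : ∀ {n} {f g : Fin n → ℕ} → (∀ i → f i ≤ g i) → sum f ≤ sum g
sum-mono-≤ {zero}  f≤g = z≤n
sum-mono-≤ {suc n} f≤g = +-mono-≤ (f≤g zero) (sum-mono-≤ (f≤g ∘ suc))

sum-zero : ∀ {n} (f : Fin n → ℕ) → (∀ i → f i ≡ 0) → sum f ≡ 0
sum-zero {n} f f≗0 = trans (sum-cong-≗ f≗0) (sum-replicate-zero n)

sum-ones : ∀ n → ∑[ i < n ] 1 ≡ n
sum-ones zero    = refl
sum-ones (suc n) = cong suc (sum-ones n)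

sum-δ : ∀ {n} (p : Fin n) → ∑[ i < n ] δ p i ≡ 1
sum-δ {suc n} zero    = cong suc (sum-replicate-zero n)
sum-δ {suc n} (suc p) = sum-δ p

module _ {a b c : ℕ} where

  count : (Triple a b c → ℕ) → ℕ
  count w = ∑[ i < a ] ∑[ j < b ] ∑[ k < c ] w (i , j , k)

  size≡count : (F : Family a b c) → size F ≡ count (λ t → ⟦ F t ⟧)
  size≡count F = trans (sum-map-tabulate id row) (sum-cong-≗ λ i →
                   trans (sum-map-tabulate id (entry i)) (sum-cong-≗ λ j →
                     sum-map-tabulate id (λ k → ⟦ F (i , j , k) ⟧)))
    where
    entry : Fin a → Fin b → ℕ
    entry i j = List.sum (map (λ k → ⟦ F (i , j , k) ⟧) (allFin c))
    row : Fin a → ℕ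
    row i = List.sum (map (entry i) (allFin b))

  count-cong : ∀ {v w : Triple a b c → ℕ} → (∀ t → v t ≡ w t) → count v ≡ count w
  count-cong v≗w = sum-cong-≗ λ i → sum-cong-≗ λ j → sum-cong-≗ λ k → v≗w (i , j , k)

  count-mono-≤ : ∀ {v w : Triple a b c → ℕ} → (∀ t → v t ≤ w t) → count v ≤ count w
  count-mono-≤ v≤w = sum-mono-≤ λ i → sum-mono-≤ λ j → sum-mono-≤ λ k → v≤w (i , j , k)

  count-zero : count (λ _ → 0) ≡ 0
  count-zero = sum-zero {a} (λ _ → ∑[ j < b ] ∑[ k < c ] 0) λ _ →
               sum-zero {b} (λ _ → ∑[ k < c ] 0) λ _ → sum-zero {c} (λ _ → 0) λ _ → refl

  count-+ : ∀ (v w : Triple a b c → ℕ) → count (λ t → v t + w t) ≡ count v + count w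
  count-+ v w = trans (sum-cong-≗ λ i →
                  trans (sum-cong-≗ λ j → ∑-distrib-+ (λ k → v (i , j , k)) (λ k → w (i , j , k)))
                        (∑-distrib-+ (λ j → ∑[ k < c ] v (i , j , k)) (λ j → ∑[ k < c ] w (i , j , k))))
                (∑-distrib-+ (λ i → ∑[ j < b ] ∑[ k < c ] v (i , j , k))
                             (λ i → ∑[ j < b ] ∑[ k < c ] w (i , j , k)))

  count-product : ∀ (f : Fin a → ℕ) (g : Fin b → ℕ) (h : Fin c → ℕ) →
                  count (λ (i , j , k) → f i * g j * h k) ≡ sum f * sum g * sum h
  count-product f g h = begin
    ∑[ i < a ] ∑[ j < b ] ∑[ k < c ] (f i * g j * h k)
      ≡⟨ sum-cong-≗ (λ i → sum-cong-≗ λ j → *-distribˡ-sum (f i * g j) h) ⟨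
    ∑[ i < a ] ∑[ j < b ] (f i * g j * sum h)
      ≡⟨ sum-cong-≗ (λ i → *-distribʳ-sum (sum h) (λ j → f i * g j)) ⟨
    ∑[ i < a ] (∑[ j < b ] (f i * g j) * sum h)
      ≡⟨ sum-cong-≗ (λ i → cong (_* sum h) (*-distribˡ-sum (f i) g)) ⟨
    ∑[ i < a ] (f i * sum g * sum h)
      ≡⟨ *-distribʳ-sum (sum h) (λ i → f i * sum g) ⟨
    ∑[ i < a ] (f i * sum g) * sum h
      ≡⟨ cong (_* sum h) (*-distribʳ-sum (sum g) f) ⟨
    sum f * sum g * sum h
      ∎
    where open ≡-Reasoning

  point : Triple a b c → Triple a b c → ℕ
  point (p , q , r) (i , j , k) = δ p i * δ q j * δ r k

  point-refl : ∀ s → point s s ≡ 1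
  point-refl (p , q , r) = cong₂ _*_ (cong₂ _*_ (δ-refl p) (δ-refl q)) (δ-refl r)

  count-point : ∀ s → count (point s) ≡ 1
  count-point (p , q , r) =
    trans (count-product (δ p) (δ q) (δ r)) (cong₂ _*_ (cong₂ _*_ (sum-δ p) (sum-δ q)) (sum-δ r))

  points : List (Triple a b c) → Triple a b c → ℕ
  points ps t = List.sum (map (λ p → point p t) ps)

  count-points : ∀ ps → count (points ps) ≡ length ps
  count-points []       = count-zero
  count-points (p ∷ ps) =
    trans (count-+ (point p) (points ps)) (cong₂ _+_ (count-point p) (count-points ps))

  ∈⇒1≤points : ∀ {t ps} → t List.∈ ps → 1 ≤ points ps t
  ∈⇒1≤points {t} (here refl) = ≤-trans (≤-reflexive (sym (point-refl t))) (m≤m+n _ _)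
  ∈⇒1≤points (there t∈ps)    = ≤-trans (∈⇒1≤points t∈ps) (m≤n+m _ _)

  size≤count : ∀ (F : Family a b c) {w} → (∀ {t} → t ∈F F → 1 ≤ w t) → size F ≤ count w
  size≤count F {w} F≤w = ≤-trans (≤-reflexive (size≡count F)) (count-mono-≤ λ t → indicator≤ (F t) F≤w)
    where
    indicator≤ : ∀ x {n} → (x ≡ true → 1 ≤ n) → ⟦ x ⟧ ≤ n
    indicator≤ false _ = z≤n
    indicator≤ true  h = h refl

  size-mono : ∀ {F G : Family a b c} → (∀ {t} → t ∈F F → t ∈F G) → size F ≤ size G
  size-mono {F} {G} F⊆G = ≤-trans (size≤count F λ t∈F → ≤-reflexive (cong ⟦_⟧ (sym (F⊆G t∈F))))
                                  (≤-reflexive (sym (size≡count G)))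

  size≤length : ∀ (F : Family a b c) ps → (∀ {t} → t ∈F F → t List.∈ ps) → size F ≤ length ps
  size≤length F ps F⊆ps = ≤-trans (size≤count F (∈⇒1≤points ∘ F⊆ps)) (≤-reflexive (count-points ps))

  meetsTwice? : (s t : Triple a b c) → Dec (MeetsTwice s t)
  meetsTwice? (p , q , r) (i , j , k) =
    (p ≟ i ×-dec q ≟ j) ⊎-dec (p ≟ i ×-dec r ≟ k) ⊎-dec (q ≟ j ×-dec r ≟ k)

  meetsTwice : Triple a b c → Family a b c
  meetsTwice s t = does (meetsTwice? s t)

  meetsTwice-complete : ∀ s t → MeetsTwice s t → t ∈F meetsTwice s
  meetsTwice-complete s t = dec-true (meetsTwice? s t)

  meetsTwice-sound : ∀ s t → t ∈F meetsTwice s → MeetsTwice s t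
  meetsTwice-sound s t e = invert (subst (Reflects (MeetsTwice s t)) e (proof (meetsTwice? s t)))

  -- Inclusion–exclusion for the three lines through s, which pairwise meet only in s.
  majority-lines : ∀ x y z → ⟦ x ∧ y ∨ x ∧ z ∨ y ∧ z ⟧ + ⟦ x ⟧ * ⟦ y ⟧ * ⟦ z ⟧ + ⟦ x ⟧ * ⟦ y ⟧ * ⟦ z ⟧
                           ≡ 1 * ⟦ y ⟧ * ⟦ z ⟧ + ⟦ x ⟧ * 1 * ⟦ z ⟧ + ⟦ x ⟧ * ⟦ y ⟧ * 1
  majority-lines false false false = refl
  majority-lines false false true  = refl
  majority-lines false true  false = refl
  majority-lines false true  true  = refl
  majority-lines true  false false = refl
  majority-lines true  false true  = refl
  majority-lines true  true  false = refl
  majority-lines true  true  true  = refl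

  size-meetsTwice+2 : ∀ s → size (meetsTwice s) + 2 ≡ a + b + c
  size-meetsTwice+2 s@(p , q , r) = begin
    size (meetsTwice s) + 2
      ≡⟨ +-assoc _ 1 1 ⟨
    size (meetsTwice s) + 1 + 1
      ≡⟨ cong₂ _+_ (cong₂ _+_ (size≡count (meetsTwice s)) (sym (count-point s))) (sym (count-point s)) ⟩
    count ⟦s⟧ + count (point s) + count (point s)
      ≡⟨ cong (_+ count (point s)) (count-+ ⟦s⟧ (point s)) ⟨
    count (λ t → ⟦s⟧ t + point s t) + count (point s)
      ≡⟨ count-+ (λ t → ⟦s⟧ t + point s t) (point s) ⟨
    count (λ t → ⟦s⟧ t + point s t + point s t)
      ≡⟨ count-cong (λ (i , j , k) → majority-lines (does (p ≟ i)) (does (q ≟ j)) (does (r ≟ k))) ⟩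
    count (λ t → line₁ t + line₂ t + line₃ t)
      ≡⟨ count-+ (λ t → line₁ t + line₂ t) line₃ ⟩
    count (λ t → line₁ t + line₂ t) + count line₃
      ≡⟨ cong (_+ count line₃) (count-+ line₁ line₂) ⟩
    count line₁ + count line₂ + count line₃
      ≡⟨ cong₂ _+_ (cong₂ _+_ count₁ count₂) count₃ ⟩
    a * 1 * 1 + 1 * b * 1 + 1 * 1 * c
      ≡⟨ units a b c ⟩
    a + b + c
      ∎
    where
    open ≡-Reasoning
    ⟦s⟧ line₁ line₂ line₃ : Triple a b c → ℕ
    ⟦s⟧ t = ⟦ meetsTwice s t ⟧
    line₁ (i , j , k) = 1 * δ q j * δ r k
    line₂ (i , j , k) = δ p i * 1 * δ r k
    line₃ (i , j , k) = δ p i * δ q j * 1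
    count₁ : count line₁ ≡ a * 1 * 1
    count₁ = trans (count-product (λ _ → 1) (δ q) (δ r))
                   (cong₂ _*_ (cong₂ _*_ (sum-ones a) (sum-δ q)) (sum-δ r))
    count₂ : count line₂ ≡ 1 * b * 1
    count₂ = trans (count-product (δ p) (λ _ → 1) (δ r))
                   (cong₂ _*_ (cong₂ _*_ (sum-δ p) (sum-ones b)) (sum-δ r))
    count₃ : count line₃ ≡ 1 * 1 * c
    count₃ = trans (count-product (δ p) (δ q) (λ _ → 1))
                   (cong₂ _*_ (cong₂ _*_ (sum-δ p) (sum-δ q)) (sum-ones c))
    units : ∀ a b c → a * 1 * 1 + 1 * b * 1 + 1 * 1 * c ≡ a + b + c
    units = solve-∀

  size-meetsTwice : ∀ s → size (meetsTwice s) ≡ a + b + c ∸ 2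
  size-meetsTwice s = trans (sym (m+n∸n≡m _ 2)) (cong (_∸ 2) (size-meetsTwice+2 s))

-- Matchings and transversals

x∈p⇒⁅x⁆⊆p : ∀ {n} {x : Fin n} {p : Subset n} → x ∈ p → ⁅ x ⁆ ⊆ p
x∈p⇒⁅x⁆⊆p {x = x} x∈p y∈⁅x⁆ = subst (_∈ _) (sym (x∈⁅y⁆⇒x≡y x y∈⁅x⁆)) x∈p

x∈p⇒1≤∣p∣ : ∀ {n} {x : Fin n} {p : Subset n} → x ∈ p → 1 ≤ ∣ p ∣
x∈p⇒1≤∣p∣ {x = x} x∈p = subst (_≤ _) (∣⁅x⁆∣≡1 x) (p⊆q⇒∣p∣≤∣q∣ (x∈p⇒⁅x⁆⊆p x∈p))

x≢y∈p⇒2≤∣p∣ : ∀ {n} {x y : Fin n} {p : Subset n} → x ∈ p → y ∈ p → x ≢ y → 2 ≤ ∣ p ∣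
x≢y∈p⇒2≤∣p∣ {x = x} {y} x∈p y∈p x≢y =
  subst (_< _) (∣⁅x⁆∣≡1 x) (p⊂q⇒∣p∣<∣q∣ (x∈p⇒⁅x⁆⊆p x∈p , y , y∈p , x≢y ∘ sym ∘ x∈⁅y⁆⇒x≡y x))

∉⁅⁆⇒≢ : ∀ {n} {x y : Fin n} → y ∉ ⁅ x ⁆ → y ≢ x
∉⁅⁆⇒≢ {x = x} y∉⁅x⁆ refl = y∉⁅x⁆ (x∈⁅x⁆ x)

module _ {a b c : ℕ} where

  Hits : Vertices a b c → Triple a b c → Set
  Hits (T₁ , T₂ , T₃) (x₁ , x₂ , x₃) = x₁ ∈ T₁ ⊎ x₂ ∈ T₂ ⊎ x₃ ∈ T₃

  hits? : ∀ T t → Dec (Hits T t)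
  hits? (T₁ , T₂ , T₃) (x₁ , x₂ , x₃) = x₁ ∈? T₁ ⊎-dec x₂ ∈? T₂ ⊎-dec x₃ ∈? T₃

  vsize≡ : ∀ {m₁ m₂ m₃} ((T₁ , T₂ , T₃) : Vertices a b c) →
           ∣ T₁ ∣ ≡ m₁ → ∣ T₂ ∣ ≡ m₂ → ∣ T₃ ∣ ≡ m₃ → vsize (T₁ , T₂ , T₃) ≡ m₁ + m₂ + m₃
  vsize≡ _ e₁ e₂ e₃ = cong₂ _+_ (cong₂ _+_ e₁ e₂) e₃

  vsize-≥ : ∀ {m₁ m₂ m₃} ((T₁ , T₂ , T₃) : Vertices a b c) →
            m₁ ≤ ∣ T₁ ∣ → m₂ ≤ ∣ T₂ ∣ → m₃ ≤ ∣ T₃ ∣ → m₁ + m₂ + m₃ ≤ vsize (T₁ , T₂ , T₃)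
  vsize-≥ _ m₁≤ m₂≤ m₃≤ = +-mono-≤ (+-mono-≤ m₁≤ m₂≤) m₃≤

  meets⇒¬disjoint : ∀ {t u : Triple a b c} → Meets t u → ¬ Disjoint t u
  meets⇒¬disjoint (inj₁ e)        (t₁≢u₁ , _ , _) = t₁≢u₁ e
  meets⇒¬disjoint (inj₂ (inj₁ e)) (_ , t₂≢u₂ , _) = t₂≢u₂ e
  meets⇒¬disjoint (inj₂ (inj₂ e)) (_ , _ , t₃≢u₃) = t₃≢u₃ e

  module _ {F : Family a b c} where

    ν≤1⇒intersecting : νAtMost F 1 → Intersecting (_∈F F)
    ν≤1⇒intersecting ν {x₁ , x₂ , x₃} {y₁ , y₂ , y₃} A B with x₁ ≟ y₁ | x₂ ≟ y₂ | x₃ ≟ y₃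
    ... | yes e | _     | _     = inj₁ e
    ... | no _  | yes e | _     = inj₂ (inj₁ e)
    ... | no _  | no _  | yes e = inj₂ (inj₂ e)
    ... | no d₁ | no d₂ | no d₃ =
      ⊥-elim (1+n≰n (ν (_ ∷ _ ∷ []) ((A ∷ B ∷ []) , ((d₁ , d₂ , d₃) ∷ []) ∷ [] ∷ [])))

    intersecting⇒ν≤1 : Intersecting (_∈F F) → νAtMost F 1
    intersecting⇒ν≤1 ∩F []          _ = z≤n
    intersecting⇒ν≤1 ∩F (_ ∷ [])    _ = s≤s z≤n
    intersecting⇒ν≤1 ∩F (_ ∷ _ ∷ _) ((A ∷ B ∷ _) , (A#B ∷ _) ∷ _) = ⊥-elim (meets⇒¬disjoint (∩F A B) A#B)

    unhit-member : τExceeds F 1 → ∀ T → vsize T ≤ 1 → ∃[ t ] t ∈F F × ¬ Hits T t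
    unhit-member τ T small
      with any? (λ i → any? λ j → any? λ k → F (i , j , k) ≟ᵇ true ×-dec ¬? (hits? T (i , j , k)))
    ... | yes (i , j , k , t∈F , miss) = (i , j , k) , t∈F , miss
    ... | no none = ⊥-elim (<⇒≱ (τ T transversal) small)
      where
      transversal : IsTransversal F T
      transversal x₁ x₂ x₃ t∈F = decidable-stable (hits? T _) λ miss → none (x₁ , x₂ , x₃ , t∈F , miss)

    admissible⇒nonTrivialIntersecting : Admissible 1 F → NonTrivialIntersecting (_∈F F)
    admissible⇒nonTrivialIntersecting (ν , τ) = record
      { intersecting = ν≤1⇒intersecting ν
      ; member       = let t , t∈F , _ = unhit-member τ ∅ (≤-trans (≤-reflexive ∣∅∣≡0) z≤n) in t , t∈F
      ; avoid₁       = λ x → let (x′ , y , z) , t∈F , miss = unhit-member τ (⁅ x ⁆ , ⊥ , ⊥)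
                                   (≤-reflexive (vsize≡ (⁅ x ⁆ , ⊥ , ⊥) (∣⁅x⁆∣≡1 x) (∣⊥∣≡0 b) (∣⊥∣≡0 c)))
                             in x′ , y , z , t∈F , ∉⁅⁆⇒≢ (miss ∘ inj₁)
      ; avoid₂       = λ y → let (x , y′ , z) , t∈F , miss = unhit-member τ (⊥ , ⁅ y ⁆ , ⊥)
                                   (≤-reflexive (vsize≡ (⊥ , ⁅ y ⁆ , ⊥) (∣⊥∣≡0 a) (∣⁅x⁆∣≡1 y) (∣⊥∣≡0 c)))
                             in x , y′ , z , t∈F , ∉⁅⁆⇒≢ (miss ∘ inj₂ ∘ inj₁)
      ; avoid₃       = λ z → let (x , y , z′) , t∈F , miss = unhit-member τ (⊥ , ⊥ , ⁅ z ⁆)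
                                   (≤-reflexive (vsize≡ (⊥ , ⊥ , ⁅ z ⁆) (∣⊥∣≡0 a) (∣⊥∣≡0 b) (∣⁅x⁆∣≡1 z)))
                             in x , y , z′ , t∈F , ∉⁅⁆⇒≢ (miss ∘ inj₂ ∘ inj₂)
      }
      where
      ∅ : Vertices a b c
      ∅ = ⊥ , ⊥ , ⊥
      ∣∅∣≡0 : vsize ∅ ≡ 0
      ∣∅∣≡0 = vsize≡ ∅ (∣⊥∣≡0 a) (∣⊥∣≡0 b) (∣⊥∣≡0 c)

    -- A transversal contains a vertex v of some member and a vertex of a member avoiding v.
    nonTrivialIntersecting⇒admissible : NonTrivialIntersecting (_∈F F) → Admissible 1 F
    nonTrivialIntersecting⇒admissible N = intersecting⇒ν≤1 intersecting , τ>1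
      where
      open NonTrivialIntersecting N
      τ>1 : τExceeds F 1
      τ>1 T hit with member
      ... | (x , y , z) , t∈F with hit x y z t∈F
      ...   | inj₁ x∈T₁ with avoid₁ x
      ...     | x′ , y′ , z′ , u∈F , x′≢x with hit x′ y′ z′ u∈F
      ...       | inj₁ x′∈T₁        = vsize-≥ T (x≢y∈p⇒2≤∣p∣ x′∈T₁ x∈T₁ x′≢x) z≤n z≤n
      ...       | inj₂ (inj₁ y′∈T₂) = vsize-≥ T (x∈p⇒1≤∣p∣ x∈T₁) (x∈p⇒1≤∣p∣ y′∈T₂) z≤n
      ...       | inj₂ (inj₂ z′∈T₃) = vsize-≥ T (x∈p⇒1≤∣p∣ x∈T₁) z≤n (x∈p⇒1≤∣p∣ z′∈T₃)
      τ>1 T hit | (x , y , z) , t∈F | inj₂ (inj₁ y∈T₂) with avoid₂ y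
      ...     | x′ , y′ , z′ , u∈F , y′≢y with hit x′ y′ z′ u∈F
      ...       | inj₁ x′∈T₁        = vsize-≥ T (x∈p⇒1≤∣p∣ x′∈T₁) (x∈p⇒1≤∣p∣ y∈T₂) z≤n
      ...       | inj₂ (inj₁ y′∈T₂) = vsize-≥ T z≤n (x≢y∈p⇒2≤∣p∣ y′∈T₂ y∈T₂ y′≢y) z≤n
      ...       | inj₂ (inj₂ z′∈T₃) = vsize-≥ T z≤n (x∈p⇒1≤∣p∣ y∈T₂) (x∈p⇒1≤∣p∣ z′∈T₃)
      τ>1 T hit | (x , y , z) , t∈F | inj₂ (inj₂ z∈T₃) with avoid₃ z
      ...     | x′ , y′ , z′ , u∈F , z′≢z with hit x′ y′ z′ u∈F
      ...       | inj₁ x′∈T₁        = vsize-≥ T (x∈p⇒1≤∣p∣ x′∈T₁) z≤n (x∈p⇒1≤∣p∣ z∈T₃)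
      ...       | inj₂ (inj₁ y′∈T₂) = vsize-≥ T z≤n (x∈p⇒1≤∣p∣ y′∈T₂) (x∈p⇒1≤∣p∣ z∈T₃)
      ...       | inj₂ (inj₂ z′∈T₃) = vsize-≥ T z≤n z≤n (x≢y∈p⇒2≤∣p∣ z′∈T₃ z∈T₃ z′≢z)

-- The extremal families

meetsTwice-nonTrivialIntersecting : ∀ {k₁ k₂ k₃} (s : Triple (2 + k₁) (2 + k₂) (2 + k₃)) →
                                    NonTrivialIntersecting (_∈F meetsTwice s)
meetsTwice-nonTrivialIntersecting s@(p , q , r) = record
  { intersecting = λ {t} {u} t∈ u∈ → meetsTwice-meets (meetsTwice-sound s t t∈) (meetsTwice-sound s u u∈)
  ; member       = s , meetsTwice-complete s s (inj₁ (refl , refl))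
  ; avoid₁       = λ x → punchIn x zero , q , r ,
                         meetsTwice-complete s (punchIn x zero , q , r) (inj₂ (inj₂ (refl , refl))) ,
                         punchInᵢ≢i x zero
  ; avoid₂       = λ y → p , punchIn y zero , r ,
                         meetsTwice-complete s (p , punchIn y zero , r) (inj₂ (inj₁ (refl , refl))) ,
                         punchInᵢ≢i y zero
  ; avoid₃       = λ z → p , q , punchIn z zero ,
                         meetsTwice-complete s (p , q , punchIn z zero) (inj₁ (refl , refl)) ,
                         punchInᵢ≢i z zero
  }

admissible⇒size≤ : ∀ {a b c} → 2 ≤ a → 2 ≤ b → 2 ≤ c →
                   (F : Family a b c) → Admissible 1 F → size F ≤ a + b + c ∸ 2
admissible⇒size≤ 2≤a 2≤b 2≤c F adm
  with shape (λ t → F t ≟ᵇ true) (admissible⇒nonTrivialIntersecting adm) _≟_ _≟_ _≟_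
... | centred s F⊆ =
  ≤-trans (size-mono {F = F} λ {t} t∈F → meetsTwice-complete s t (F⊆ t∈F)) (≤-reflexive (size-meetsTwice s))
... | fourPoints _ _ _ _ F⊆ =
  ≤-trans (size≤length F _ F⊆) (∸-monoˡ-≤ 2 (+-mono-≤ (+-mono-≤ 2≤a 2≤b) 2≤c))

M0Is-1 : ∀ {a b c} → 2 ≤ a → 2 ≤ b → 2 ≤ c → M0Is 1 a b c (a + b + c ∸ 2)
M0Is-1 2≤a@(s≤s (s≤s _)) 2≤b@(s≤s (s≤s _)) 2≤c@(s≤s (s≤s _)) =
  (meetsTwice s₀ , nonTrivialIntersecting⇒admissible (meetsTwice-nonTrivialIntersecting s₀) ,
   size-meetsTwice s₀) ,
  admissible⇒size≤ 2≤a 2≤b 2≤c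
  where
  s₀ = zero , zero , zero

theorem1p8 : ∀ (n₁ n₂ n₃ : ℕ) → n₁ ≥ n₂ → n₂ ≥ n₃ → n₃ ≥ 2 →
    M0Is 1 n₁ n₂ n₃ (n₁ + n₂ + n₃ ∸ 2)
theorem1p8 n₁ n₂ n₃ n₁≥n₂ n₂≥n₃ n₃≥2 = M0Is-1 (≤-trans n₂≥2 n₁≥n₂) n₂≥2 n₃≥2
  where
  n₂≥2 = ≤-trans n₃≥2 n₂≥n₃
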